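{- Let ${\to_{[\mathsf{ch}]}}\subseteq P\times[\mathbb{A}](\mathit{Act}\times P)$ be an equivariant relation, and let ${\to}\subseteq P\times(\mathit{Act}\times P)$ be its translation. Then $\to$ is equivariant: if $p\to(\ell,p')$ then $\pi\cdot p\to(\pi\cdot\ell,\pi\cdot p')$ for every permutation $\pi$.
   Context: Let $\mathbb{A}$ be a countably infinite set of atoms; permutations are bijections of $\mathbb{A}$ moving finitely many atoms, $(a\ b)$ transpositions ($(a\ a)$ is the identity). A nominal set is a set with a permutation action whose elements are finitely supported; $\mathrm{supp}(s)$ is the least support; $s_1\#s_2$ iff supports are disjoint; products carry the componentwise action; equivariant = closed under/commuting with all permutations. Atom abstraction: $\langle a\rangle s=\{(b,(b\ a)\cdot s)\mid b=a\text{ or }b\#s\}$, with $\pi\cdot\langle a\rangle s=\langle\pi(a)\rangle(\pi\cdot s)$; $[\mathbb{A}]S$ is the nominal set of abstractions. $P$ and $\mathit{Act}$ are nominal sets. The translation of $\to_{[\mathsf{ch}]}$ is the least relation ${\to}\subseteq P\times(\mathit{Act}\times P)$ such that for all $p,a,\ell,p'$: if $p\to_{[\mathsf{ch}]}\langle a\rangle(\ell,p')$ then $p\to((b\ a)\cdot\ell,(b\ a)\cdot p')$ for $b=a$ and for every atom $b$ with $b\#(\ell,p')$. -}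

module Defs where

open import Data.Nat using (ℕ; _≟_)
open import Data.List using (List; []; _∷_; _++_)
open import Data.List.Membership.Propositional using (_∈_; _∉_)
open import Data.List.Membership.Propositional.Properties using (∈-++⁺ˡ; ∈-++⁺ʳ)
open import Data.List.Relation.Unary.Any using (here; there)
open import Data.Product using (Σ; ∃; _×_; _,_; proj₁; proj₂)
open import Data.Sum using (_⊎_)
open import Relation.Nullary using (¬_; yes; no)
open import Relation.Binary.PropositionalEquality using (_≡_; refl; sym; trans; cong)
open import Function using (_⇔_)

Atom : Set
Atom = ℕ

record Perm : Set where
  field
    to      : Atom → Atom
    from    : Atom → Atom
    from∘to : ∀ a → from (to a) ≡ a
    to∘from : ∀ a → to (from a) ≡ a
    dom     : List Atom
    fixed   : ∀ a → a ∉ dom → to a ≡ a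
open Perm public

idP : Perm
idP = record { to = λ a → a ; from = λ a → a ; from∘to = λ _ → refl
             ; to∘from = λ _ → refl ; dom = [] ; fixed = λ _ _ → refl }

_∘P_ : Perm → Perm → Perm
π ∘P σ = record
  { to = λ a → to π (to σ a)
  ; from = λ a → from σ (from π a)
  ; from∘to = λ a → trans (cong (from σ) (from∘to π (to σ a))) (from∘to σ a)
  ; to∘from = λ a → trans (cong (to π) (to∘from σ (from π a))) (to∘from π a)
  ; dom = dom π ++ dom σ
  ; fixed = λ a a∉ → trans (cong (to π) (fixed σ a (λ a∈ → a∉ (∈-++⁺ʳ (dom π) a∈))))
                           (fixed π a (λ a∈ → a∉ (∈-++⁺ˡ a∈)))
  }

-- the transposition (a b); (a a) is the identity function
swapA : Atom → Atom → Atom → Atom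
swapA a b c with c ≟ a
... | yes _ = b
... | no _ with c ≟ b
...   | yes _ = a
...   | no _ = c

private
  swap-inv : ∀ a b c → swapA a b (swapA a b c) ≡ c
  swap-inv a b c with c ≟ a
  swap-inv a b c | yes c≡a with b ≟ a
  swap-inv a b c | yes c≡a | yes b≡a = trans b≡a (sym c≡a)
  swap-inv a b c | yes c≡a | no _ with b ≟ b
  swap-inv a b c | yes c≡a | no _ | yes _ = sym c≡a
  swap-inv a b c | yes c≡a | no _ | no b≢b with b≢b refl
  ... | ()
  swap-inv a b c | no c≢a with c ≟ b
  swap-inv a b c | no c≢a | yes c≡b with a ≟ a
  swap-inv a b c | no c≢a | yes c≡b | yes _ = sym c≡b
  swap-inv a b c | no c≢a | yes c≡b | no a≢a with a≢a refl
  ... | ()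
  swap-inv a b c | no c≢a | no c≢b with c ≟ a
  swap-inv a b c | no c≢a | no c≢b | yes c≡a with c≢a c≡a
  ... | ()
  swap-inv a b c | no c≢a | no c≢b | no _ with c ≟ b
  swap-inv a b c | no c≢a | no c≢b | no _ | yes c≡b with c≢b c≡b
  ... | ()
  swap-inv a b c | no c≢a | no c≢b | no _ | no _ = refl

  swap-fixed : ∀ a b c → c ∉ (a ∷ b ∷ []) → swapA a b c ≡ c
  swap-fixed a b c c∉ with c ≟ a
  ... | yes c≡a with c∉ (here c≡a)
  ...   | ()
  swap-fixed a b c c∉ | no _ with c ≟ b
  ... | yes c≡b with c∉ (there (here c≡b))
  ...   | ()
  swap-fixed a b c c∉ | no _ | no _ = refl

⦅_⇄_⦆ : Atom → Atom → Perm
⦅ a ⇄ b ⦆ = record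
  { to = swapA a b ; from = swapA a b
  ; from∘to = swap-inv a b ; to∘from = swap-inv a b
  ; dom = a ∷ b ∷ [] ; fixed = swap-fixed a b }

Supports : {X : Set} → (Perm → X → X) → List Atom → X → Set
Supports act A x = ∀ π → (∀ a → a ∈ A → to π a ≡ a) → act π x ≡ x

-- b is fresh for x (b ∉ supp x, the least support): since the least
-- support is the intersection of all finite supports, b ∉ supp(x) iff
-- some finite support of x does not contain b.
Fresh : {X : Set} → (Perm → X → X) → Atom → X → Set
Fresh act b x = Σ (List Atom) λ A → Supports act A x × b ∉ A

record Nominal : Set₁ where
  field
    Carrier : Set
    _·_     : Perm → Carrier → Carrier
    act-id  : ∀ x → idP · x ≡ x
    act-∘   : ∀ π σ x → (π ∘P σ) · x ≡ π · (σ · x)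
    act-ext : ∀ π σ → (∀ a → to π a ≡ to σ a) → ∀ x → π · x ≡ σ · x
    finsupp : ∀ x → Σ (List Atom) λ A → Supports _·_ A x
open Nominal public

_⊢_#_ : (S : Nominal) → Atom → Carrier S → Set
S ⊢ b # x = Fresh (_·_ S) b x

_⊗_ : Nominal → Nominal → Nominal
S ⊗ T = record
  { Carrier = Carrier S × Carrier T
  ; _·_ = λ π st → (_·_ S π (proj₁ st)) , (_·_ T π (proj₂ st))
  ; act-id = λ st → cong₂' (act-id S (proj₁ st)) (act-id T (proj₂ st))
  ; act-∘ = λ π σ st → cong₂' (act-∘ S π σ (proj₁ st)) (act-∘ T π σ (proj₂ st))
  ; act-ext = λ π σ e st → cong₂' (act-ext S π σ e (proj₁ st)) (act-ext T π σ e (proj₂ st))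
  ; finsupp = λ st → let (A , sA) = finsupp S (proj₁ st) ; (B , sB) = finsupp T (proj₂ st) in
      (A ++ B) , λ π fix → cong₂' (sA π (λ a a∈ → fix a (∈-++⁺ˡ a∈)))
                                   (sB π (λ a a∈ → fix a (∈-++⁺ʳ A a∈)))
  }
  where
  cong₂' : ∀ {A B : Set} {a a' : A} {b b' : B} → a ≡ a' → b ≡ b' → (a , b) ≡ (a' , b')
  cong₂' refl refl = refl

-- Atom abstraction ⟨a⟩s = {(b, (b a)·s) | b = a or b # s}, as a
-- subset (predicate) of 𝔸 × S.

⟨_⟩_∋_ : {S : Nominal} → Atom → Carrier S → Atom × Carrier S → Set
⟨_⟩_∋_ {S} a s (b , t) = (b ≡ a ⊎ S ⊢ b # s) × t ≡ _·_ S ⦅ b ⇄ a ⦆ s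

AbsEq : (S : Nominal) → Atom → Carrier S → Atom → Carrier S → Set
AbsEq S a s a' s' = ∀ bt → (⟨_⟩_∋_ {S} a s bt) ⇔ (⟨_⟩_∋_ {S} a' s' bt)

-- A relation R ⊆ P × [𝔸]S, presented by R p a s meaning p R ⟨a⟩s.
-- Well-definedness: it depends only on the abstraction ⟨a⟩s (a set).
RelAbs : (P S : Nominal) → Set₁
RelAbs P S = Carrier P → Atom → Carrier S → Set

WellDefinedAbs : (P S : Nominal) → RelAbs P S → Set
WellDefinedAbs P S R = ∀ p a s a' s' → AbsEq S a s a' s' → R p a s → R p a' s'

-- Equivariance, using π·⟨a⟩s = ⟨π(a)⟩(π·s)
EquivariantAbs : (P S : Nominal) → RelAbs P S → Set
EquivariantAbs P S R = ∀ π p a s → R p a s → R (_·_ P π p) (to π a) (_·_ S π s)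

data Translation (P Act : Nominal) (R : RelAbs P (Act ⊗ P))
     : Carrier P → Carrier Act × Carrier P → Set where
  tr : ∀ {p a ℓ p'} → R p a (ℓ , p') → (b : Atom)
     → (b ≡ a ⊎ (Act ⊗ P) ⊢ b # (ℓ , p'))
     → Translation P Act R p (_·_ Act ⦅ b ⇄ a ⦆ ℓ , _·_ P ⦅ b ⇄ a ⦆ p')

module Submission where

open import Defs
open import Data.Empty using (⊥-elim)
open import Function using (_∘_)
open import Data.List using (List; map)
open import Data.List.Membership.Propositional using (_∈_; _∉_)
open import Data.List.Membership.Propositional.Properties using (∈-map⁺; ∈-map⁻)
open import Data.Nat using (_≟_)
open import Data.Product using (_,_)
open import Data.Sum as Sum using (_⊎_)
open import Relation.Nullary using (¬_; yes; no)
open import Relation.Binary.PropositionalEquality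

-- A permutation π commutes with transpositions up to renaming them:
-- π ∘ (b a) = (π b  π a) ∘ π.  Consequently π maps the instance of the
-- translation rule at (a, b) to its instance at (π a, π b), freshness
-- included, and the translation inherits equivariance from →[ch].

swapA-left : ∀ a b c → c ≡ a → swapA a b c ≡ b
swapA-left a b c c≡a with c ≟ a
... | yes _   = refl
... | no c≢a  = ⊥-elim (c≢a c≡a)

swapA-right : ∀ a b c → ¬ c ≡ a → c ≡ b → swapA a b c ≡ a
swapA-right a b c c≢a c≡b with c ≟ a
... | yes c≡a = ⊥-elim (c≢a c≡a)
... | no _ with c ≟ b
...   | yes _   = refl
...   | no c≢b  = ⊥-elim (c≢b c≡b)

swapA-other : ∀ a b c → ¬ c ≡ a → ¬ c ≡ b → swapA a b c ≡ c
swapA-other a b c c≢a c≢b with c ≟ a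
... | yes c≡a = ⊥-elim (c≢a c≡a)
... | no _ with c ≟ b
...   | yes c≡b = ⊥-elim (c≢b c≡b)
...   | no _    = refl

to-injective : (π : Perm) → ∀ {x y} → to π x ≡ to π y → x ≡ y
to-injective π {x} {y} πx≡πy = begin
  x                ≡⟨ sym (from∘to π x) ⟩
  from π (to π x)  ≡⟨ cong (from π) πx≡πy ⟩
  from π (to π y)  ≡⟨ from∘to π y ⟩
  y                ∎
  where open ≡-Reasoning

to-swapA : (π : Perm) → ∀ a b c → to π (swapA a b c) ≡ swapA (to π a) (to π b) (to π c)
to-swapA π a b c with c ≟ a
... | yes c≡a = sym (swapA-left _ _ _ (cong (to π) c≡a))
... | no c≢a with c ≟ b
...   | yes c≡b = sym (swapA-right _ _ _ (c≢a ∘ to-injective π) (cong (to π) c≡b))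
...   | no c≢b  = sym (swapA-other _ _ _ (c≢a ∘ to-injective π) (c≢b ∘ to-injective π))

infix 30 _⁻¹P

_⁻¹P : Perm → Perm
π ⁻¹P = record
  { to = from π ; from = to π ; from∘to = to∘from π ; to∘from = from∘to π
  ; dom = dom π
  ; fixed = λ a a∉ → trans (cong (from π) (sym (fixed π a a∉))) (from∘to π a) }

module _ (S : Nominal) where

  ·-swap : (π : Perm) (a b : Atom) (x : Carrier S)
    → _·_ S π (_·_ S ⦅ a ⇄ b ⦆ x) ≡ _·_ S ⦅ to π a ⇄ to π b ⦆ (_·_ S π x)
  ·-swap π a b x = begin
    _·_ S π (_·_ S ⦅ a ⇄ b ⦆ x)               ≡⟨ act-∘ S π ⦅ a ⇄ b ⦆ x ⟨
    _·_ S (π ∘P ⦅ a ⇄ b ⦆) x                 ≡⟨ act-ext S _ _ (to-swapA π a b) x ⟩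
    _·_ S (⦅ to π a ⇄ to π b ⦆ ∘P π) x       ≡⟨ act-∘ S ⦅ to π a ⇄ to π b ⦆ π x ⟩
    _·_ S ⦅ to π a ⇄ to π b ⦆ (_·_ S π x)     ∎
    where open ≡-Reasoning

  Supports-· : (π : Perm) {A : List Atom} {x : Carrier S}
    → Supports (_·_ S) A x → Supports (_·_ S) (map (to π) A) (_·_ S π x)
  Supports-· π {A} {x} A-supports σ σ-fixes = begin
    _·_ S σ (_·_ S π x)                ≡⟨ act-∘ S σ π x ⟨
    _·_ S (σ ∘P π) x                   ≡⟨ act-ext S _ _ (λ _ → sym (to∘from π _)) x ⟩
    _·_ S (π ∘P σᵖ) x                  ≡⟨ act-∘ S π σᵖ x ⟩
    _·_ S π (_·_ S σᵖ x)               ≡⟨ cong (_·_ S π) (A-supports σᵖ σᵖ-fixes) ⟩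
    _·_ S π x                          ∎
    where
    open ≡-Reasoning
    σᵖ : Perm
    σᵖ = π ⁻¹P ∘P (σ ∘P π)
    σᵖ-fixes : ∀ a → a ∈ A → to σᵖ a ≡ a
    σᵖ-fixes a a∈A = trans (cong (from π) (σ-fixes (to π a) (∈-map⁺ (to π) a∈A))) (from∘to π a)

  #-equivariant : (π : Perm) (b : Atom) (x : Carrier S)
    → S ⊢ b # x → S ⊢ to π b # _·_ S π x
  #-equivariant π b x (A , A-supports , b∉A) = map (to π) A , Supports-· π A-supports , πb∉πA
    where
    πb∉πA : to π b ∉ map (to π) A
    πb∉πA πb∈πA with ∈-map⁻ (to π) πb∈πA
    ... | c , c∈A , πb≡πc = b∉A (subst (_∈ A) (sym (to-injective π πb≡πc)) c∈A)

lemma7p5 : (P Act : Nominal) (R : RelAbs P (Act ⊗ P))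
    → WellDefinedAbs P (Act ⊗ P) R
    → EquivariantAbs P (Act ⊗ P) R
    → ∀ (π : Perm) p ℓ p'
    → Translation P Act R p (ℓ , p')
    → Translation P Act R (_·_ P π p) (_·_ Act π ℓ , _·_ P π p')
lemma7p5 P Act R _ R-equivariant π p _ _ (tr {a = a} {ℓ} {p'} p→⟨a⟩ℓp' b b-side) =
  subst (Translation P Act R (_·_ P π p))
    (sym (cong₂ _,_ (·-swap Act π b a ℓ) (·-swap P π b a p')))
    (tr (R-equivariant π p a (ℓ , p') p→⟨a⟩ℓp') (to π b) πb-side)
  where
  πb-side : to π b ≡ to π a ⊎ (Act ⊗ P) ⊢ to π b # (_·_ Act π ℓ , _·_ P π p')
  πb-side = Sum.map (cong (to π)) (#-equivariant (Act ⊗ P) π b (ℓ , p')) b-side
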